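{- Let $G$ be a finite bipartite graph with color classes $A$ and $B$, and $b:V(G)\to\mathbb{Z}_{\ge0}$. Let $C$ be an inconsistent flexible component hooked up by $A$. Then for every flexible component $D$ that is not an inconsistent flexible component hooked up by $A$, every edge joining $V(C)\cap A$ to $V(D)\cap B$ is inevitable, and every edge joining $V(D)\cap A$ to $V(C)\cap B$ is forbidden.
   Context: A $b$-matching is $M\subseteq E(G)$ with at most $b(v)$ edges of $M$ at each $v$; maximum = largest cardinality; $v$ is $M$-loose if fewer than $b(v)$ edges of $M$ are incident with it. An edge is allowed if in some maximum $b$-matching, forbidden otherwise; an allowed edge is inevitable if in every maximum $b$-matching, flexible otherwise. Flexible components: induced subgraphs $G[V(K)]$, $K$ a connected component of $(V(G),\{\text{flexible edges}\})$. $\mathcal{D}$: vertices $M$-loose for some maximum $b$-matching $M$. $v$ is inactive if $b(v)=0$ (then $G[\{v\}]$ is an inactive flexible component). A flexible component $C$ is inconsistent hooked up by $A$ if $V(C)\cap\mathcal{D}\cap A\ne\emptyset$, or $C$ is inactive and its vertex has a neighbor in $\mathcal{D}\cap A$. -}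

module Defs where

open import Data.Nat using (ℕ; zero; suc; _+_; _≤_; _<_)
open import Data.Fin using (Fin)
open import Data.Bool using (Bool; true; false)
open import Data.Sum using (_⊎_; inj₁; inj₂)
open import Data.Product using (Σ; _×_; ∃; ∃-syntax; _,_)
open import Relation.Nullary using (¬_)
open import Relation.Binary.PropositionalEquality using (_≡_)
open import Relation.Binary.Construct.Closure.ReflexiveTransitive using (Star)

sumFin : (n : ℕ) → (Fin n → ℕ) → ℕ
sumFin zero    f = 0
sumFin (suc n) f = f Fin.zero + sumFin n (λ i → f (Fin.suc i))

bit : Bool → ℕ
bit true  = 1
bit false = 0

-- A finite simple bipartite graph with colour classes A = Fin p and B = Fin q;
-- E i j ≡ true iff the vertex i ∈ A is adjacent to the vertex j ∈ B.
record BipGraph : Set where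
  field
    p q : ℕ
    E   : Fin p → Fin q → Bool

module _ (G : BipGraph) where
  open BipGraph G

  -- V(G) = A ⊎ B  (inj₁ = colour class A, inj₂ = colour class B)
  Vertex : Set
  Vertex = Fin p ⊎ Fin q

  InA : Vertex → Set
  InA v = Σ (Fin p) λ i → v ≡ inj₁ i

  InB : Vertex → Set
  InB v = Σ (Fin q) λ j → v ≡ inj₂ j

  Adj : Vertex → Vertex → Set
  Adj (inj₁ i) (inj₂ j) = E i j ≡ true
  Adj (inj₂ j) (inj₁ i) = E i j ≡ true
  Adj _ _ = ⊥'
    where open import Data.Empty renaming (⊥ to ⊥')

  -- an edge set, given by its indicator; an edge set is M ⊆ E(G) (see IsBMatching)
  EdgeSet : Set
  EdgeSet = Fin p → Fin q → Bool

  size : EdgeSet → ℕ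
  size M = sumFin p λ i → sumFin q λ j → bit (M i j)

  deg : EdgeSet → Vertex → ℕ
  deg M (inj₁ i) = sumFin q λ j → bit (M i j)
  deg M (inj₂ j) = sumFin p λ i → bit (M i j)

  module _ (b : Vertex → ℕ) where

    IsBMatching : EdgeSet → Set
    IsBMatching M = (∀ i j → M i j ≡ true → E i j ≡ true)
                  × (∀ v → deg M v ≤ b v)

    IsMaximum : EdgeSet → Set
    IsMaximum M = IsBMatching M × (∀ M' → IsBMatching M' → size M' ≤ size M)

    Allowed : Fin p → Fin q → Set
    Allowed i j = ∃[ M ] (IsMaximum M × M i j ≡ true)

    Forbidden : Fin p → Fin q → Set
    Forbidden i j = E i j ≡ true × ¬ Allowed i j

    Inevitable : Fin p → Fin q → Set
    Inevitable i j = Allowed i j × (∀ M → IsMaximum M → M i j ≡ true)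

    Flexible : Fin p → Fin q → Set
    Flexible i j = Allowed i j × ¬ (∀ M → IsMaximum M → M i j ≡ true)

    FlexAdj : Vertex → Vertex → Set
    FlexAdj (inj₁ i) (inj₂ j) = Flexible i j
    FlexAdj (inj₂ j) (inj₁ i) = Flexible i j
    FlexAdj _ _ = ⊥'
      where open import Data.Empty renaming (⊥ to ⊥')

    SameComp : Vertex → Vertex → Set
    SameComp = Star FlexAdj

    -- A flexible component is represented by any of its vertices c;
    -- its vertex set is { v | SameComp c v }.
    InComp : Vertex → Vertex → Set
    InComp c v = SameComp c v

    InD : Vertex → Set
    InD v = ∃[ M ] (IsMaximum M × deg M v < b v)

    -- the flexible component of c is inactive: it is G[{c}] with b(c) = 0
    -- (a vertex with b = 0 is incident with no allowed edge, so its component is a singleton)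
    InactiveComp : Vertex → Set
    InactiveComp c = b c ≡ 0

    InconsistentHookedA : Vertex → Set
    InconsistentHookedA c =
        (∃[ v ] (InComp c v × InA v × InD v))
      ⊎ (InactiveComp c × ∃[ w ] (Adj c w × InA w × InD w))

-- Fix a maximum b-matching M and let X be the set of vertices reachable from an M-loose vertex of A
-- by an M-alternating path (non-M edges from A to B, M edges back). Since M admits no augmenting path,
-- M exactly attains the weak-duality bound given by the cover (A ∖ X) ∪ (B ∩ X) together with the
-- edges from X ∩ A to B ∖ X; hence so does every maximum b-matching, which therefore contains every
-- edge from X ∩ A to B ∖ X, no edge from A ∖ X to B ∩ X, and saturates A ∖ X. Consequently no
-- flexible edge leaves X and 𝒟 ∩ A ⊆ X, so the component of C lies in X. Conversely switching M along
-- alternating paths shows X ∩ A ⊆ 𝒟, and a vertex of X ∩ B is inactive next to X ∩ A or joined to it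
-- by a flexible edge, so the component of D misses X. X is decidable only classically, which is
-- harmless because all conclusions are stable under double negation.

module Submission where

open import Defs
open import Data.Nat using (ℕ; zero; suc; _+_; _≤_; _<_; z≤n; s≤s; z<s)
open import Data.Nat.Properties hiding (_≟_)
open import Data.Fin using (Fin; zero; suc; _≟_)
import Data.Fin.Properties as Finₚ
open import Data.Bool using (Bool; true; false; not; _∧_; if_then_else_)
import Data.Bool.Properties as Bool
open import Data.Product using (Σ; ∃; _×_; _,_; proj₁; proj₂)
open import Data.Sum using (_⊎_; inj₁; inj₂)
open import Data.Sum.Properties using (≡-dec; inj₂-injective)
open import Data.List using (List; []; _∷_)
open import Data.List.Relation.Unary.Any using (here; there)
open import Function using (_∘_)
open import Relation.Nullary using (¬_; Dec; does; yes; no; contradiction)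
open import Relation.Nullary.Decidable using (decidable-stable; ¬¬-excluded-middle)
open import Relation.Nullary.Negation using (Stable; negated-stable)
open import Relation.Binary.PropositionalEquality
open import Relation.Binary.Construct.Closure.ReflexiveTransitive using (ε; _◅_; _◅◅_; reverse)
open import Algebra.Properties.Semiring.Sum +-*-semiring using (sum; ∑-distrib-+; ∑-comm; sum-replicate-zero)

-- Finite sums

infix 7 _when_

_when_ : ℕ → Bool → ℕ
n when a = if a then n else 0

sumFin-cong : ∀ n {f g : Fin n → ℕ} → (∀ i → f i ≡ g i) → sumFin n f ≡ sumFin n g
sumFin-cong zero    f≗g = refl
sumFin-cong (suc n) f≗g = cong₂ _+_ (f≗g zero) (sumFin-cong n (f≗g ∘ suc))

sumFin≡sum : ∀ n (f : Fin n → ℕ) → sumFin n f ≡ sum f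
sumFin≡sum zero    f = refl
sumFin≡sum (suc n) f = cong (f zero +_) (sumFin≡sum n (f ∘ suc))

sumFin-distrib-+ : ∀ n (f g : Fin n → ℕ) →
  sumFin n (λ i → f i + g i) ≡ sumFin n f + sumFin n g
sumFin-distrib-+ n f g = begin
  sumFin n (λ i → f i + g i)  ≡⟨ sumFin≡sum n _ ⟩
  sum (λ i → f i + g i)       ≡⟨ ∑-distrib-+ f g ⟩
  sum f + sum g               ≡⟨ cong₂ _+_ (sumFin≡sum n f) (sumFin≡sum n g) ⟨
  sumFin n f + sumFin n g     ∎
  where open ≡-Reasoning

sumFin-comm : ∀ m n (f : Fin m → Fin n → ℕ) →
  sumFin m (λ i → sumFin n (f i)) ≡ sumFin n (λ j → sumFin m (λ i → f i j))
sumFin-comm m n f = begin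
  sumFin m (λ i → sumFin n (f i))          ≡⟨ sumFin-cong m (λ i → sumFin≡sum n (f i)) ⟩
  sumFin m (λ i → sum (f i))               ≡⟨ sumFin≡sum m _ ⟩
  sum (λ i → sum (f i))                    ≡⟨ ∑-comm f ⟩
  sum (λ j → sum (λ i → f i j))            ≡⟨ sumFin≡sum n _ ⟨
  sumFin n (λ j → sum (λ i → f i j))       ≡⟨ sumFin-cong n (λ j → sumFin≡sum m (λ i → f i j)) ⟨
  sumFin n (λ j → sumFin m (λ i → f i j))  ∎
  where open ≡-Reasoning

sumFin-when : ∀ n a (f : Fin n → ℕ) → sumFin n (λ i → f i when a) ≡ sumFin n f when a
sumFin-when n true  f = refl
sumFin-when n false f = trans (sumFin≡sum n _) (sum-replicate-zero n)

when-mono : ∀ a {m n} → m ≤ n → m when a ≤ n when a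
when-mono true  m≤n = m≤n
when-mono false _   = z≤n

sumFin-mono : ∀ n {f g : Fin n → ℕ} → (∀ i → f i ≤ g i) → sumFin n f ≤ sumFin n g
sumFin-mono zero    f≤g = z≤n
sumFin-mono (suc n) f≤g = +-mono-≤ (f≤g zero) (sumFin-mono n (f≤g ∘ suc))

sumFin-mono-≡ : ∀ n {f g : Fin n → ℕ} → (∀ i → f i ≤ g i) → sumFin n g ≤ sumFin n f →
  ∀ i → f i ≡ g i
sumFin-mono-≡ (suc n) {f} f≤g Σg≤Σf zero =
  ≤-antisym (f≤g zero) (+-cancelʳ-≤ _ _ _ (≤-trans Σg≤Σf (+-monoʳ-≤ (f zero) (sumFin-mono n (f≤g ∘ suc)))))
sumFin-mono-≡ (suc n) f≤g Σg≤Σf (suc i) =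
  sumFin-mono-≡ n (f≤g ∘ suc) (+-cancelˡ-≤ _ _ _ (≤-trans Σg≤Σf (+-monoˡ-≤ _ (f≤g zero)))) i

sumFin-term : ∀ n (f : Fin n → ℕ) i → f i ≤ sumFin n f
sumFin-term (suc n) f zero    = m≤m+n _ _
sumFin-term (suc n) f (suc i) = ≤-trans (sumFin-term n (f ∘ suc) i) (m≤n+m _ _)

sumFin-pos : ∀ n (f : Fin n → ℕ) → 0 < sumFin n f → ∃ λ i → 0 < f i
sumFin-pos (suc n) f pos with f zero in eq
... | suc _ = zero , subst (0 <_) (sym eq) z<s
... | zero with sumFin-pos n (f ∘ suc) pos
...   | i , fi>0 = suc i , fi>0

sumFin-suc-at : ∀ n {f g : Fin n → ℕ} k → (∀ i → ¬ i ≡ k → f i ≡ g i) → g k ≡ suc (f k) →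
  sumFin n g ≡ suc (sumFin n f)
sumFin-suc-at (suc n) zero    f≗g gk = cong₂ _+_ gk (sym (sumFin-cong n (λ i → f≗g (suc i) λ ())))
sumFin-suc-at (suc n) {f} (suc k) f≗g gk =
  trans (cong₂ _+_ (sym (f≗g zero λ ())) (sumFin-suc-at n k (λ i i≢k → f≗g (suc i) (i≢k ∘ Finₚ.suc-injective)) gk))
        (+-suc (f zero) _)

-- Edge sets and single-edge changes

bit-mono : ∀ {x y} → (x ≡ true → y ≡ true) → bit x ≤ bit y
bit-mono {false} x⇒y = z≤n
bit-mono {true}  x⇒y rewrite x⇒y refl = ≤-refl

bit-pos : ∀ x → 0 < bit x → x ≡ true
bit-pos true _ = refl

module _ (G : BipGraph) where
  open BipGraph G

  infix 4 _⊆ₑ_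

  _⊆ₑ_ : EdgeSet G → EdgeSet G → Set
  N ⊆ₑ N' = ∀ i j → N i j ≡ true → N' i j ≡ true

  deg-mono : ∀ {N N'} → N ⊆ₑ N' → ∀ v → deg G N v ≤ deg G N' v
  deg-mono N⊆N' (inj₁ i) = sumFin-mono q λ j → bit-mono (N⊆N' i j)
  deg-mono N⊆N' (inj₂ j) = sumFin-mono p λ i → bit-mono (N⊆N' i j)

  edge⇒degA-pos : ∀ N i j → N i j ≡ true → 0 < deg G N (inj₁ i)
  edge⇒degA-pos N i j Nij = subst (λ x → bit x ≤ deg G N (inj₁ i)) Nij (sumFin-term q (λ j → bit (N i j)) j)

  edge⇒degB-pos : ∀ N i j → N i j ≡ true → 0 < deg G N (inj₂ j)
  edge⇒degB-pos N i j Nij = subst (λ x → bit x ≤ deg G N (inj₂ j)) Nij (sumFin-term p (λ i → bit (N i j)) i)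

  degB-pos⇒edge : ∀ N j → 0 < deg G N (inj₂ j) → ∃ λ i → N i j ≡ true
  degB-pos⇒edge N j pos with sumFin-pos p (λ i → bit (N i j)) pos
  ... | i , bit>0 = i , bit-pos _ bit>0

  update : EdgeSet G → Fin p → Fin q → Bool → EdgeSet G
  update N i₀ j₀ x i j with i ≟ i₀ | j ≟ j₀
  ... | yes _ | yes _ = x
  ... | _     | _     = N i j

  update-same : ∀ N i₀ j₀ x → update N i₀ j₀ x i₀ j₀ ≡ x
  update-same N i₀ j₀ x with i₀ ≟ i₀ | j₀ ≟ j₀
  ... | yes _  | yes _  = refl
  ... | no i≢i | _      = contradiction refl i≢i
  ... | yes _  | no j≢j = contradiction refl j≢j

  update-other : ∀ N i₀ j₀ x i j → ¬ (i ≡ i₀ × j ≡ j₀) → update N i₀ j₀ x i j ≡ N i j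
  update-other N i₀ j₀ x i j ij≢ with i ≟ i₀ | j ≟ j₀
  ... | yes i≡ | yes j≡ = contradiction (i≡ , j≡) ij≢
  ... | yes _  | no _   = refl
  ... | no _   | yes _  = refl
  ... | no _   | no _   = refl

  update-⊆E : ∀ N i₀ j₀ x → (∀ i j → N i j ≡ true → E i j ≡ true) → (x ≡ true → E i₀ j₀ ≡ true) →
    ∀ i j → update N i₀ j₀ x i j ≡ true → E i j ≡ true
  update-⊆E N i₀ j₀ x N⊆E x⇒E i j with i ≟ i₀ | j ≟ j₀
  ... | yes refl | yes refl = x⇒E
  ... | yes _    | no _     = N⊆E i j
  ... | no _     | yes _    = N⊆E i j
  ... | no _     | no _     = N⊆E i j

  record AddsEdge (N N' : EdgeSet G) (i₀ : Fin p) (j₀ : Fin q) : Set where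
    field
      absent    : N i₀ j₀ ≡ false
      present   : N' i₀ j₀ ≡ true
      unchanged : ∀ i j → ¬ (i ≡ i₀ × j ≡ j₀) → N i j ≡ N' i j

    private
      bit-step : bit (N' i₀ j₀) ≡ suc (bit (N i₀ j₀))
      bit-step rewrite absent | present = refl

    subset : N ⊆ₑ N'
    subset i j Nij with i ≟ i₀ | j ≟ j₀
    ... | yes refl | yes refl = present
    ... | yes _    | no j≢    = trans (sym (unchanged i j (j≢ ∘ proj₂))) Nij
    ... | no i≢    | _        = trans (sym (unchanged i j (i≢ ∘ proj₁))) Nij

    degA-endpoint : deg G N' (inj₁ i₀) ≡ suc (deg G N (inj₁ i₀))
    degA-endpoint = sumFin-suc-at q j₀ (λ j j≢ → cong bit (unchanged i₀ j (j≢ ∘ proj₂))) bit-step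

    degB-endpoint : deg G N' (inj₂ j₀) ≡ suc (deg G N (inj₂ j₀))
    degB-endpoint = sumFin-suc-at p i₀ (λ i i≢ → cong bit (unchanged i j₀ (i≢ ∘ proj₁))) bit-step

    degA-other : ∀ i → ¬ i ≡ i₀ → deg G N' (inj₁ i) ≡ deg G N (inj₁ i)
    degA-other i i≢ = sym (sumFin-cong q λ j → cong bit (unchanged i j (i≢ ∘ proj₁)))

    degB-other : ∀ j → ¬ j ≡ j₀ → deg G N' (inj₂ j) ≡ deg G N (inj₂ j)
    degB-other j j≢ = sym (sumFin-cong p λ i → cong bit (unchanged i j (j≢ ∘ proj₂)))

    size-suc : size G N' ≡ suc (size G N)
    size-suc = sumFin-suc-at p i₀ (λ i i≢ → sym (degA-other i i≢)) degA-endpoint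

    bounded-exceptB : (b : Vertex G → ℕ) → (∀ v → deg G N v ≤ b v) →
      deg G N (inj₁ i₀) < b (inj₁ i₀) → ∀ v → ¬ v ≡ inj₂ j₀ → deg G N' v ≤ b v
    bounded-exceptB b N≤b i₀-loose (inj₁ i) _ with i ≟ i₀
    ... | yes refl = ≤-trans (≤-reflexive degA-endpoint) i₀-loose
    ... | no i≢    = ≤-trans (≤-reflexive (degA-other i i≢)) (N≤b (inj₁ i))
    bounded-exceptB b N≤b i₀-loose (inj₂ j) v≢ =
      ≤-trans (≤-reflexive (degB-other j (v≢ ∘ cong inj₂))) (N≤b (inj₂ j))

    bounded : (b : Vertex G → ℕ) → (∀ v → deg G N v ≤ b v) →
      deg G N (inj₁ i₀) < b (inj₁ i₀) → deg G N (inj₂ j₀) < b (inj₂ j₀) → ∀ v → deg G N' v ≤ b v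
    bounded b N≤b i₀-loose j₀-loose (inj₁ i) = bounded-exceptB b N≤b i₀-loose (inj₁ i) λ ()
    bounded b N≤b i₀-loose j₀-loose (inj₂ j) with j ≟ j₀
    ... | yes refl = ≤-trans (≤-reflexive degB-endpoint) j₀-loose
    ... | no j≢    = bounded-exceptB b N≤b i₀-loose (inj₂ j) (j≢ ∘ inj₂-injective)

    shrink-bounded : (b : Vertex G → ℕ) → (∀ v → ¬ v ≡ inj₂ j₀ → deg G N' v ≤ b v) →
      deg G N (inj₂ j₀) ≤ b (inj₂ j₀) → ∀ v → deg G N v ≤ b v
    shrink-bounded b N'≤b j₀-bounded (inj₁ i) = ≤-trans (deg-mono subset (inj₁ i)) (N'≤b (inj₁ i) λ ())
    shrink-bounded b N'≤b j₀-bounded (inj₂ j) with j ≟ j₀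
    ... | yes refl = j₀-bounded
    ... | no j≢    = ≤-trans (deg-mono subset (inj₂ j)) (N'≤b (inj₂ j) (j≢ ∘ inj₂-injective))

  adding : ∀ N i₀ j₀ → N i₀ j₀ ≡ false → AddsEdge N (update N i₀ j₀ true) i₀ j₀
  adding N i₀ j₀ Nij = record
    { absent = Nij ; present = update-same N i₀ j₀ true
    ; unchanged = λ i j ij≢ → sym (update-other N i₀ j₀ true i j ij≢) }

  removing : ∀ N i₀ j₀ → N i₀ j₀ ≡ true → AddsEdge (update N i₀ j₀ false) N i₀ j₀
  removing N i₀ j₀ Nij = record
    { absent = update-same N i₀ j₀ false ; present = Nij
    ; unchanged = λ i j ij≢ → update-other N i₀ j₀ false i j ij≢ }

-- b-matchings and flexible components

module _ (G : BipGraph) (b : Vertex G → ℕ) where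
  open BipGraph G

  Loose : EdgeSet G → Vertex G → Set
  Loose N v = deg G N v < b v

  maximum-of-size : ∀ {M N} → IsMaximum G b M → IsBMatching G b N → size G M ≤ size G N →
    IsMaximum G b N
  maximum-of-size (_ , M-max) N-bm M≤N = N-bm , λ N' N'-bm → ≤-trans (M-max N' N'-bm) M≤N

  maximum-size : ∀ {M N} → IsMaximum G b M → IsMaximum G b N → size G N ≡ size G M
  maximum-size (M-bm , M-max) (N-bm , N-max) = ≤-antisym (M-max _ N-bm) (N-max _ M-bm)

  maximum-no-augmenting-edge : ∀ {N i j} → IsMaximum G b N → E i j ≡ true → N i j ≡ false →
    Loose N (inj₁ i) → ¬ Loose N (inj₂ j)
  maximum-no-augmenting-edge {N} {i} {j} ((N⊆E , N≤b) , N-max) Eij Nij i-loose j-loose =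
    <-irrefl refl (≤-trans (≤-reflexive (sym size-suc)) (N-max _ (N'⊆E , N'≤b)))
    where
    open AddsEdge (adding G N i j Nij)
    N'⊆E = update-⊆E G N i j true N⊆E (λ _ → Eij)
    N'≤b = bounded b N≤b i-loose j-loose

  -- Exchanging the edge i₂ j of N for i j keeps N maximum.
  exchange-allowed : ∀ {N i i₂ j} → IsMaximum G b N → E i j ≡ true → N i j ≡ false →
    N i₂ j ≡ true → Loose N (inj₁ i) → Allowed G b i j
  exchange-allowed {N} {i} {i₂} {j} N-maxm@((N⊆E , N≤b) , _) Eij Nij Ni₂j i-loose =
    N₂ , maximum-of-size N-maxm (N₂⊆E , N₂≤b) (≤-reflexive N₂-size) , present
    where
    N₁ = update G N i₂ j false
    N₂ = update G N₁ i j true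
    remove : AddsEdge G N₁ N i₂ j
    remove = removing G N i₂ j Ni₂j
    N₁ij : N₁ i j ≡ false
    N₁ij = trans (AddsEdge.unchanged remove i j λ { (refl , _) → contradiction (trans (sym Nij) Ni₂j) λ () })
                 Nij
    add : AddsEdge G N₁ N₂ i j
    add = adding G N₁ i j N₁ij
    open AddsEdge add using (present)
    N₂⊆E = update-⊆E G N₁ i j true (update-⊆E G N i₂ j false N⊆E λ ()) (λ _ → Eij)
    N₁≤N = deg-mono G (AddsEdge.subset remove)
    N₂≤b = AddsEdge.bounded add b (λ v → ≤-trans (N₁≤N v) (N≤b v))
             (≤-<-trans (N₁≤N (inj₁ i)) i-loose)
             (≤-trans (≤-reflexive (sym (AddsEdge.degB-endpoint remove))) (N≤b (inj₂ j)))
    N₂-size : size G N ≡ size G N₂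
    N₂-size = trans (AddsEdge.size-suc remove) (sym (AddsEdge.size-suc add))

  flexAdj-sym : ∀ {u v} → FlexAdj G b u v → FlexAdj G b v u
  flexAdj-sym {inj₁ _} {inj₂ _} uv = uv
  flexAdj-sym {inj₂ _} {inj₁ _} uv = uv

  inComp-sym : ∀ {u v} → InComp G b u v → InComp G b v u
  inComp-sym = reverse flexAdj-sym

  inactive-isolated : ∀ v u → b v ≡ 0 → ¬ FlexAdj G b v u
  inactive-isolated (inj₁ i) (inj₂ j) bv≡0 ((N , ((_ , N≤b) , _) , Nij) , _) =
    <-irrefl (sym bv≡0) (≤-trans (edge⇒degA-pos G N i j Nij) (N≤b (inj₁ i)))
  inactive-isolated (inj₂ j) (inj₁ i) bv≡0 ((N , ((_ , N≤b) , _) , Nij) , _) =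
    <-irrefl (sym bv≡0) (≤-trans (edge⇒degB-pos G N i j Nij) (N≤b (inj₂ j)))

  inactive-comp : ∀ {d v} → b v ≡ 0 → InComp G b d v → d ≡ v
  inactive-comp bv≡0 d~v with inComp-sym d~v
  ... | ε        = refl
  ... | v~u ◅ _  = contradiction v~u (inactive-isolated _ _ bv≡0)

-- Weak duality for covers

-- For an edge ij with a = [i ∈ S], c = [j ∈ S], n = [ij ∈ N] and e = [ij ∈ E]: how often ij ∈ N is
-- counted by the degrees of the cover (A ∖ S) ∪ (B ∩ S), plus 1 if ij is an edge of G missed by it.
coverCell : (a c n e : Bool) → ℕ
coverCell a c n e = bit n when not a + bit n when c + bit e when (a ∧ not c)

bit≤coverCell : ∀ a c n e → (n ≡ true → e ≡ true) → bit n ≤ coverCell a c n e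
bit≤coverCell a     c     false e n⇒e = z≤n
bit≤coverCell true  true  true  e n⇒e = ≤-refl
bit≤coverCell true  false true  e n⇒e rewrite n⇒e refl = ≤-refl
bit≤coverCell false true  true  e n⇒e = s≤s z≤n
bit≤coverCell false false true  e n⇒e = ≤-refl

coverCell≤bit : ∀ a c n e →
  (a ≡ true → c ≡ false → e ≡ true → n ≡ true) → (a ≡ false → c ≡ true → n ≡ false) →
  coverCell a c n e ≤ bit n
coverCell≤bit true  true  n     e     _    _   = ≤-reflexive (+-identityʳ (bit n))
coverCell≤bit true  false n     false _    _   = z≤n
coverCell≤bit true  false n     true  in⇒n _   rewrite in⇒n refl refl refl = ≤-refl
coverCell≤bit false true  n     e     _    out⇒¬n rewrite out⇒¬n refl refl = z≤n
coverCell≤bit false false n     e     _    _   = ≤-reflexive (trans (+-identityʳ _) (+-identityʳ _))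

coverCell-in : ∀ n → bit n ≡ coverCell true false n true → n ≡ true
coverCell-in true _ = refl

coverCell-out : ∀ n e → bit n ≡ coverCell false true n e → n ≡ false
coverCell-out false e _ = refl

module Cover (G : BipGraph) (b : Vertex G → ℕ) {S : Vertex G → Set} (S? : ∀ v → Dec (S v)) where
  open BipGraph G

  inS : Vertex G → Bool
  inS v = does (S? v)

  cell : EdgeSet G → Fin p → Fin q → ℕ
  cell N i j = coverCell (inS (inj₁ i)) (inS (inj₂ j)) (N i j) (E i j)

  coveredA : (Vertex G → ℕ) → ℕ
  coveredA w = sumFin p λ i → w (inj₁ i) when not (inS (inj₁ i))

  coveredB : (Vertex G → ℕ) → ℕ
  coveredB w = sumFin q λ j → w (inj₂ j) when inS (inj₂ j)

  uncovered : ℕ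
  uncovered = sumFin p λ i → sumFin q λ j → bit (E i j) when (inS (inj₁ i) ∧ not (inS (inj₂ j)))

  capacity : ℕ
  capacity = coveredA b + coveredB b + uncovered

  cells : EdgeSet G → ℕ
  cells N = sumFin p λ i → sumFin q (cell N i)

  cells-sum : ∀ N → cells N ≡ coveredA (deg G N) + coveredB (deg G N) + uncovered
  cells-sum N = begin
    cells N
      ≡⟨ sumFin-cong p (λ i → trans (sumFin-distrib-+ q (λ j → x i j + y i j) (z i))
                                    (cong (_+ sumFin q (z i)) (sumFin-distrib-+ q (x i) (y i)))) ⟩
    sumFin p (λ i → sumFin q (x i) + sumFin q (y i) + sumFin q (z i))
      ≡⟨ trans (sumFin-distrib-+ p _ _) (cong (_+ uncovered) (sumFin-distrib-+ p _ _)) ⟩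
    Σx + Σy + uncovered
      ≡⟨ cong₂ (λ s t → s + t + uncovered) Σx≡ Σy≡ ⟩
    coveredA (deg G N) + coveredB (deg G N) + uncovered ∎
    where
    open ≡-Reasoning
    x y z : Fin p → Fin q → ℕ
    x i j = bit (N i j) when not (inS (inj₁ i))
    y i j = bit (N i j) when inS (inj₂ j)
    z i j = bit (E i j) when (inS (inj₁ i) ∧ not (inS (inj₂ j)))
    Σx = sumFin p λ i → sumFin q (x i)
    Σy = sumFin p λ i → sumFin q (y i)
    Σx≡ : Σx ≡ coveredA (deg G N)
    Σx≡ = sumFin-cong p λ i → sumFin-when q _ (λ j → bit (N i j))
    Σy≡ : Σy ≡ coveredB (deg G N)
    Σy≡ = trans (sumFin-comm p q y) (sumFin-cong q λ j → sumFin-when p _ (λ i → bit (N i j)))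

  size≤cells : ∀ N → (∀ i j → N i j ≡ true → E i j ≡ true) → size G N ≤ cells N
  size≤cells N N⊆E = sumFin-mono p λ i → sumFin-mono q λ j →
    bit≤coverCell (inS (inj₁ i)) (inS (inj₂ j)) (N i j) (E i j) (N⊆E i j)

  coveredA-mono : ∀ {w w' : Vertex G → ℕ} → (∀ i → ¬ S (inj₁ i) → w (inj₁ i) ≤ w' (inj₁ i)) →
    coveredA w ≤ coveredA w'
  coveredA-mono {w} {w'} w≤w' = sumFin-mono p pointwise
    where
    pointwise : ∀ i → w (inj₁ i) when not (inS (inj₁ i)) ≤ w' (inj₁ i) when not (inS (inj₁ i))
    pointwise i with S? (inj₁ i)
    ... | yes _ = z≤n
    ... | no ¬s = w≤w' i ¬s

  coveredB-mono : ∀ {w w' : Vertex G → ℕ} → (∀ j → S (inj₂ j) → w (inj₂ j) ≤ w' (inj₂ j)) →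
    coveredB w ≤ coveredB w'
  coveredB-mono {w} {w'} w≤w' = sumFin-mono q pointwise
    where
    pointwise : ∀ j → w (inj₂ j) when inS (inj₂ j) ≤ w' (inj₂ j) when inS (inj₂ j)
    pointwise j with S? (inj₂ j)
    ... | yes s = w≤w' j s
    ... | no _  = z≤n

  cells≤capacity : ∀ {N} → IsBMatching G b N → cells N ≤ capacity
  cells≤capacity {N} (_ , N≤b) = ≤-trans (≤-reflexive (cells-sum N)) (+-monoˡ-≤ uncovered (+-mono-≤
    (coveredA-mono {deg G N} {b} λ i _ → N≤b (inj₁ i))
    (coveredB-mono {deg G N} {b} λ j _ → N≤b (inj₂ j))))

  Tight : EdgeSet G → Set
  Tight N = capacity ≤ size G N

  tight-cells : ∀ {N} → IsBMatching G b N → Tight N → ∀ i j → bit (N i j) ≡ cell N i j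
  tight-cells {N} N-bm@(N⊆E , _) tight i = sumFin-mono-≡ q (bit≤cell i) (≤-reflexive (sym (rows i)))
    where
    bit≤cell : ∀ i j → bit (N i j) ≤ cell N i j
    bit≤cell i j = bit≤coverCell (inS (inj₁ i)) (inS (inj₂ j)) (N i j) (E i j) (N⊆E i j)
    rows = sumFin-mono-≡ p (λ i → sumFin-mono q (bit≤cell i)) (≤-trans (cells≤capacity N-bm) tight)

  tight-contains : ∀ {N} → IsBMatching G b N → Tight N →
    ∀ i j → S (inj₁ i) → ¬ S (inj₂ j) → E i j ≡ true → N i j ≡ true
  tight-contains {N} N-bm tight i j si ¬sj Eij with S? (inj₁ i) | S? (inj₂ j) | tight-cells N-bm tight i j
  ... | yes _  | no _   | bit≡cell = coverCell-in (N i j) (trans bit≡cell (cong (coverCell true false (N i j)) Eij))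
  ... | no ¬si | _      | _        = contradiction si ¬si
  ... | yes _  | yes sj | _        = contradiction sj ¬sj

  tight-avoids : ∀ {N} → IsBMatching G b N → Tight N →
    ∀ i j → ¬ S (inj₁ i) → S (inj₂ j) → N i j ≡ false
  tight-avoids {N} N-bm tight i j ¬si sj with S? (inj₁ i) | S? (inj₂ j) | tight-cells N-bm tight i j
  ... | no _   | yes _  | bit≡cell = coverCell-out (N i j) (E i j) bit≡cell
  ... | yes si | _      | _        = contradiction si ¬si
  ... | no _   | no ¬sj | _        = contradiction sj ¬sj

  tight-coveredA : ∀ {N} → IsBMatching G b N → Tight N → coveredA b ≤ coveredA (deg G N)
  tight-coveredA {N} (N⊆E , N≤b) tight = +-cancelʳ-≤ (coveredB b) _ _ (+-cancelʳ-≤ uncovered _ _ (begin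
    capacity                                             ≤⟨ tight ⟩
    size G N                                             ≤⟨ size≤cells N N⊆E ⟩
    cells N                                              ≡⟨ cells-sum N ⟩
    coveredA (deg G N) + coveredB (deg G N) + uncovered  ≤⟨ +-monoˡ-≤ uncovered (+-monoʳ-≤ (coveredA (deg G N))
                                                              (coveredB-mono {deg G N} {b} λ j _ → N≤b (inj₂ j))) ⟩
    coveredA (deg G N) + coveredB b + uncovered          ∎))
    where open ≤-Reasoning

  tight-saturatesA : ∀ {N} → IsBMatching G b N → Tight N →
    ∀ i → ¬ S (inj₁ i) → deg G N (inj₁ i) ≡ b (inj₁ i)
  tight-saturatesA {N} N-bm@(_ , N≤b) tight i ¬si
    with S? (inj₁ i)
       | sumFin-mono-≡ p (λ i → when-mono (not (inS (inj₁ i))) (N≤b (inj₁ i))) (tight-coveredA N-bm tight) i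
  ... | yes si | _     = contradiction si ¬si
  ... | no _   | deg≡b = deg≡b

  tight-of-closed : ∀ {N} → (∀ i j → N i j ≡ true → E i j ≡ true) →
    (∀ i j → S (inj₁ i) → ¬ S (inj₂ j) → E i j ≡ true → N i j ≡ true) →
    (∀ i j → ¬ S (inj₁ i) → S (inj₂ j) → N i j ≡ false) →
    (∀ i → ¬ S (inj₁ i) → b (inj₁ i) ≤ deg G N (inj₁ i)) →
    (∀ j → S (inj₂ j) → b (inj₂ j) ≤ deg G N (inj₂ j)) → Tight N
  tight-of-closed {N} N⊆E contains avoids saturatedA saturatedB = begin
    capacity                                             ≤⟨ +-monoˡ-≤ uncovered (+-mono-≤
                                                              (coveredA-mono {b} {deg G N} saturatedA)
                                                              (coveredB-mono {b} {deg G N} saturatedB)) ⟩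
    coveredA (deg G N) + coveredB (deg G N) + uncovered  ≡⟨ cells-sum N ⟨
    cells N                                              ≤⟨ sumFin-mono p (λ i → sumFin-mono q (cell≤bit i)) ⟩
    size G N                                             ∎
    where
    open ≤-Reasoning
    cell≤bit : ∀ i j → cell N i j ≤ bit (N i j)
    cell≤bit i j with S? (inj₁ i) | S? (inj₂ j)
    ... | yes si | no ¬sj = coverCell≤bit true false (N i j) (E i j) (λ _ _ → contains i j si ¬sj) (λ ())
    ... | no ¬si | yes sj = coverCell≤bit false true (N i j) (E i j) (λ ()) (λ _ _ → avoids i j ¬si sj)
    ... | yes _  | yes _  = coverCell≤bit true true (N i j) (E i j) (λ _ ()) (λ ())
    ... | no _   | no _   = coverCell≤bit false false (N i j) (E i j) (λ ()) (λ _ ())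

-- Alternating paths

module AlternatingPaths (G : BipGraph) (b : Vertex G → ℕ) {M : EdgeSet G} (M-maxm : IsMaximum G b M) where
  open BipGraph G
  open import Data.List.Membership.DecPropositional (≡-dec (_≟_ {p}) (_≟_ {q})) using (_∈_; _∉_; _∈?_)

  private
    M⊆E = proj₁ (proj₁ M-maxm)
    M≤b = proj₂ (proj₁ M-maxm)

  -- vs lists the vertices of the path, latest first; keeping paths simple is what makes switching
  -- M along them valid.
  data AltPath : Vertex G → List (Vertex G) → Set where
    start       : ∀ i → Loose G b M (inj₁ i) → AltPath (inj₁ i) (inj₁ i ∷ [])
    nonMatching : ∀ {i vs} j → AltPath (inj₁ i) vs → E i j ≡ true → M i j ≡ false → inj₂ j ∉ vs →
                  AltPath (inj₂ j) (inj₂ j ∷ vs)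
    matching    : ∀ {j vs} i → AltPath (inj₂ j) vs → M i j ≡ true → inj₁ i ∉ vs →
                  AltPath (inj₁ i) (inj₁ i ∷ vs)

  Reachable : Vertex G → Set
  Reachable v = ∃ (AltPath v)

  altPath-head : ∀ {v vs} → AltPath v vs → v ∈ vs
  altPath-head (start _ _)             = here refl
  altPath-head (nonMatching _ _ _ _ _) = here refl
  altPath-head (matching _ _ _ _)      = here refl

  altPath-reachable : ∀ {v vs w} → AltPath v vs → w ∈ vs → Reachable w
  altPath-reachable P@(start _ _)             (here refl) = _ , P
  altPath-reachable P@(nonMatching _ _ _ _ _) (here refl) = _ , P
  altPath-reachable P@(matching _ _ _ _)      (here refl) = _ , P
  altPath-reachable (nonMatching _ P _ _ _) (there w∈)  = altPath-reachable P w∈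
  altPath-reachable (matching _ P _ _)      (there w∈)  = altPath-reachable P w∈

  reachable-nonMatching : ∀ {i j} → Reachable (inj₁ i) → E i j ≡ true → M i j ≡ false → Reachable (inj₂ j)
  reachable-nonMatching {j = j} (vs , P) Eij Mij with inj₂ j ∈? vs
  ... | yes j∈ = altPath-reachable P j∈
  ... | no j∉  = _ , nonMatching j P Eij Mij j∉

  reachable-matching : ∀ {i j} → Reachable (inj₂ j) → M i j ≡ true → Reachable (inj₁ i)
  reachable-matching {i} (vs , P) Mij with inj₁ i ∈? vs
  ... | yes i∈ = altPath-reachable P i∈
  ... | no i∉  = _ , matching i P Mij i∉

  AgreesOff : List (Vertex G) → EdgeSet G → Set
  AgreesOff vs N = ∀ i j → inj₁ i ∉ vs ⊎ inj₂ j ∉ vs → N i j ≡ M i j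

  agreesOff-extend : ∀ {vs w N N' i₀ j₀} → AgreesOff vs N →
    (∀ i j → ¬ (i ≡ i₀ × j ≡ j₀) → N' i j ≡ N i j) → inj₁ i₀ ∈ w ∷ vs → inj₂ j₀ ∈ w ∷ vs →
    AgreesOff (w ∷ vs) N'
  agreesOff-extend agrees N'≗N i₀∈ j₀∈ i j (inj₁ i∉) =
    trans (N'≗N i j λ { (refl , _) → i∉ i₀∈ }) (agrees i j (inj₁ (i∉ ∘ there)))
  agreesOff-extend agrees N'≗N i₀∈ j₀∈ i j (inj₂ j∉) =
    trans (N'≗N i j λ { (_ , refl) → j∉ j₀∈ }) (agrees i j (inj₂ (j∉ ∘ there)))

  agreesOff-degA : ∀ {vs N i} → AgreesOff vs N → inj₁ i ∉ vs → deg G N (inj₁ i) ≡ deg G M (inj₁ i)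
  agreesOff-degA agrees i∉ = sumFin-cong q λ j → cong bit (agrees _ j (inj₁ i∉))

  agreesOff-degB : ∀ {vs N j} → AgreesOff vs N → inj₂ j ∉ vs → deg G N (inj₂ j) ≡ deg G M (inj₂ j)
  agreesOff-degB agrees j∉ = sumFin-cong p λ i → cong bit (agrees i _ (inj₂ j∉))

  record SwitchedToA (i : Fin p) (vs : List (Vertex G)) : Set where
    field
      N           : EdgeSet G
      isBMatching : IsBMatching G b N
      size≡       : size G N ≡ size G M
      loose       : Loose G b N (inj₁ i)
      agrees      : AgreesOff vs N

  record SwitchedToB (j : Fin q) (vs : List (Vertex G)) : Set where
    field
      N        : EdgeSet G
      N⊆E      : ∀ i j → N i j ≡ true → E i j ≡ true
      bounded  : ∀ v → ¬ v ≡ inj₂ j → deg G N v ≤ b v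
      excess   : deg G N (inj₂ j) ≡ suc (deg G M (inj₂ j))
      size-suc : size G N ≡ suc (size G M)
      agrees   : AgreesOff vs N

  Switched : Vertex G → List (Vertex G) → Set
  Switched (inj₁ i) = SwitchedToA i
  Switched (inj₂ j) = SwitchedToB j

  switch : ∀ {v vs} → AltPath v vs → Switched v vs
  switch (start i loose) = record
    { N = M ; isBMatching = proj₁ M-maxm ; size≡ = refl ; loose = loose ; agrees = λ _ _ _ → refl }
  switch (nonMatching {i} {vs} j P Eij Mij j∉) = record
    { N = update G N i j true
    ; N⊆E = update-⊆E G N i j true (proj₁ isBMatching) (λ _ → Eij)
    ; bounded = bounded-exceptB b (proj₂ isBMatching) loose
    ; excess = trans degB-endpoint (cong suc (agreesOff-degB agrees j∉))
    ; size-suc = trans size-suc (cong suc size≡)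
    ; agrees = agreesOff-extend agrees (λ i j ij≢ → sym (unchanged i j ij≢))
                 (there (altPath-head P)) (here refl) }
    where
    open SwitchedToA (switch P)
    open AddsEdge (adding G N i j (trans (agrees i j (inj₂ j∉)) Mij))
  switch (matching {j} {vs} i P Mij i∉) = record
    { N = N'
    ; isBMatching = update-⊆E G N i j false N⊆E (λ ()) , N'≤b
    ; size≡ = suc-injective (trans (sym size-suc) S.size-suc)
    ; loose = ≤-trans (≤-reflexive (trans (sym degA-endpoint) (agreesOff-degA S.agrees i∉))) (M≤b (inj₁ i))
    ; agrees = agreesOff-extend S.agrees unchanged (here refl) (there (altPath-head P)) }
    where
    module S = SwitchedToB (switch P)
    open S using (N; N⊆E)
    N' = update G N i j false
    open AddsEdge (removing G N i j (trans (S.agrees i j (inj₁ i∉)) Mij))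
    N'≤b : ∀ v → deg G N' v ≤ b v
    N'≤b = shrink-bounded b S.bounded
      (≤-trans (≤-reflexive (suc-injective (trans (sym degB-endpoint) S.excess))) (M≤b (inj₂ j)))

  reachableB-saturated : ∀ {j} → Reachable (inj₂ j) → ¬ Loose G b M (inj₂ j)
  reachableB-saturated {j} (_ , P) j-loose =
    <-irrefl refl (≤-trans (≤-reflexive (sym size-suc)) (proj₂ M-maxm N (N⊆E , N≤b)))
    where
    open SwitchedToB (switch P)
    N≤b : ∀ v → deg G N v ≤ b v
    N≤b (inj₁ i) = bounded (inj₁ i) λ ()
    N≤b (inj₂ j') with j' ≟ j
    ... | yes refl = ≤-trans (≤-reflexive excess) j-loose
    ... | no j'≢j  = bounded (inj₂ j') (j'≢j ∘ inj₂-injective)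

  switchedToA-maximum : ∀ {i vs} (S : SwitchedToA i vs) → IsMaximum G b (SwitchedToA.N S)
  switchedToA-maximum S = maximum-of-size G b M-maxm isBMatching (≤-reflexive (sym size≡))
    where open SwitchedToA S

  reachableA-inD : ∀ {i} → Reachable (inj₁ i) → InD G b (inj₁ i)
  reachableA-inD (_ , P) = N , switchedToA-maximum (switch P) , loose
    where open SwitchedToA (switch P)

  reachable-hooked : ∀ {d v} → Reachable v → InComp G b d v → InconsistentHookedA G b d
  reachable-hooked {v = inj₁ i} i-reachable d~i = inj₁ (inj₁ i , d~i , (i , refl) , reachableA-inD i-reachable)
  reachable-hooked {d} {inj₂ j} (_ , nonMatching {i} j P Eij Mij j∉) d~j = by-capacity (b (inj₂ j)) refl
    where
    open SwitchedToA (switch P)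
    N-maxm = switchedToA-maximum (switch P)
    Nij : N i j ≡ false
    Nij = trans (agrees i j (inj₂ j∉)) Mij
    i-inD : InD G b (inj₁ i)
    i-inD = N , N-maxm , loose
    by-capacity : ∀ k → b (inj₂ j) ≡ k → InconsistentHookedA G b d
    by-capacity zero bj≡0 rewrite inactive-comp G b bj≡0 d~j = inj₂ (bj≡0 , inj₁ i , Eij , (i , refl) , i-inD)
    by-capacity (suc _) bj≡suc = inj₁ (inj₁ i , d~j ◅◅ (j~i ◅ ε) , (i , refl) , i-inD)
      where
      degj-pos : 0 < deg G N (inj₂ j)
      degj-pos = <-≤-trans (subst (0 <_) (sym bj≡suc) z<s)
                           (≮⇒≥ (maximum-no-augmenting-edge G b N-maxm Eij Nij loose))
      j~i : FlexAdj G b (inj₂ j) (inj₁ i)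
      j~i = exchange-allowed G b N-maxm Eij Nij (proj₂ (degB-pos⇒edge G N j degj-pos)) loose ,
            λ inevitable → contradiction (trans (sym (inevitable N N-maxm)) Nij) λ ()

  unhooked-unreachable : ∀ {d v} → ¬ InconsistentHookedA G b d → InComp G b d v → ¬ Reachable v
  unhooked-unreachable ¬hd d~v v-reachable = ¬hd (reachable-hooked v-reachable d~v)

  module _ (X? : ∀ v → Dec (Reachable v)) where
    open Cover G b X?

    M-tight : Tight M
    M-tight = tight-of-closed M⊆E contains avoids saturatedA saturatedB
      where
      contains : ∀ i j → Reachable (inj₁ i) → ¬ Reachable (inj₂ j) → E i j ≡ true → M i j ≡ true
      contains i j i-r ¬j-r Eij with M i j in Mij
      ... | true  = refl
      ... | false = contradiction (reachable-nonMatching i-r Eij Mij) ¬j-r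
      avoids : ∀ i j → ¬ Reachable (inj₁ i) → Reachable (inj₂ j) → M i j ≡ false
      avoids i j ¬i-r j-r with M i j in Mij
      ... | false = refl
      ... | true  = contradiction (reachable-matching j-r Mij) ¬i-r
      saturatedA : ∀ i → ¬ Reachable (inj₁ i) → b (inj₁ i) ≤ deg G M (inj₁ i)
      saturatedA i ¬i-r = ≮⇒≥ λ i-loose → ¬i-r (_ , start i i-loose)
      saturatedB : ∀ j → Reachable (inj₂ j) → b (inj₂ j) ≤ deg G M (inj₂ j)
      saturatedB j j-r = ≮⇒≥ (reachableB-saturated j-r)

    maximum-tight : ∀ {N} → IsMaximum G b N → Tight N
    maximum-tight N-maxm = ≤-trans M-tight (≤-reflexive (sym (maximum-size G b M-maxm N-maxm)))

    maximum-contains : ∀ {N i j} → IsMaximum G b N →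
      Reachable (inj₁ i) → ¬ Reachable (inj₂ j) → E i j ≡ true → N i j ≡ true
    maximum-contains N-maxm = tight-contains (proj₁ N-maxm) (maximum-tight N-maxm) _ _

    maximum-avoids : ∀ {N i j} → IsMaximum G b N → ¬ Reachable (inj₁ i) → Reachable (inj₂ j) → N i j ≡ false
    maximum-avoids N-maxm = tight-avoids (proj₁ N-maxm) (maximum-tight N-maxm) _ _

    inD-reachable : ∀ {i} → InD G b (inj₁ i) → Reachable (inj₁ i)
    inD-reachable {i} (N , N-maxm , i-loose) with X? (inj₁ i)
    ... | yes i-r = i-r
    ... | no ¬i-r = contradiction i-loose (<-irrefl (tight-saturatesA (proj₁ N-maxm) (maximum-tight N-maxm) i ¬i-r))

    flexAdj-reachable : ∀ {u v} → Reachable u → FlexAdj G b u v → Reachable v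
    flexAdj-reachable {inj₁ i} {inj₂ j} i-r ((N , ((N⊆E , _) , _) , Nij) , ¬inevitable) with X? (inj₂ j)
    ... | yes j-r = j-r
    ... | no ¬j-r = contradiction (λ N' N'-maxm → maximum-contains N'-maxm i-r ¬j-r (N⊆E i j Nij)) ¬inevitable
    flexAdj-reachable {inj₂ j} {inj₁ i} j-r ((N , N-maxm , Nij) , _) with X? (inj₁ i)
    ... | yes i-r = i-r
    ... | no ¬i-r = contradiction (trans (sym Nij) (maximum-avoids N-maxm ¬i-r j-r)) λ ()

    inComp-reachable : ∀ {u v} → Reachable u → InComp G b u v → Reachable v
    inComp-reachable u-r ε          = u-r
    inComp-reachable u-r (uw ◅ w~v) = inComp-reachable (flexAdj-reachable u-r uw) w~v

    hooked-reachable : ∀ {c v} → InconsistentHookedA G b c → InComp G b c v → Reachable v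
    hooked-reachable (inj₁ (w , c~w , (i , refl) , inD)) c~v =
      inComp-reachable (inD-reachable inD) (inComp-sym G b c~w ◅◅ c~v)
    hooked-reachable {inj₂ j} (inj₂ (bj≡0 , inj₁ i , Eij , (_ , refl) , inD)) c~v with X? (inj₂ j)
    ... | yes j-r = inComp-reachable j-r c~v
    ... | no ¬j-r = contradiction (≤-trans (edge⇒degB-pos G M i j Mij) (M≤b (inj₂ j))) (<-irrefl (sym bj≡0))
      where
      Mij : M i j ≡ true
      Mij = maximum-contains M-maxm (inD-reachable inD) ¬j-r Eij

-- Classical decidability

¬¬-decidableFin : ∀ n (P : Fin n → Set) → ¬ ¬ (∀ i → Dec (P i))
¬¬-decidableFin zero    P ¬dec = ¬dec λ ()
¬¬-decidableFin (suc n) P ¬dec = ¬¬-excluded-middle λ P0? → ¬¬-decidableFin n (P ∘ suc) λ P+? →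
  ¬dec λ { zero → P0? ; (suc i) → P+? i }

¬¬-decidable⊎ : ∀ m n (P : Fin m ⊎ Fin n → Set) → ¬ ¬ (∀ v → Dec (P v))
¬¬-decidable⊎ m n P ¬dec = ¬¬-decidableFin m (P ∘ inj₁) λ P₁? → ¬¬-decidableFin n (P ∘ inj₂) λ P₂? →
  ¬dec λ { (inj₁ i) → P₁? i ; (inj₂ j) → P₂? j }

assuming-decidable : ∀ {m n} {A : Set} (P : Fin m ⊎ Fin n → Set) → Stable A → ((∀ v → Dec (P v)) → A) → A
assuming-decidable {m} {n} P stable k = stable λ ¬a → ¬¬-decidable⊎ m n P (¬a ∘ k)

hooked-maximum : ∀ G b {c} → InconsistentHookedA G b c → Σ (EdgeSet G) (IsMaximum G b)
hooked-maximum G b (inj₁ (_ , _ , _ , M , M-maxm , _))     = M , M-maxm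
hooked-maximum G b (inj₂ (_ , _ , _ , _ , M , M-maxm , _)) = M , M-maxm

mainTheorem15 : (G : BipGraph) (b : Vertex G → ℕ) →
    let open BipGraph G in
    (c : Vertex G) → InconsistentHookedA G b c →
    (d : Vertex G) → ¬ InconsistentHookedA G b d →
      ((i : Fin p) (j : Fin q) → InComp G b c (inj₁ i) → InComp G b d (inj₂ j) →
         E i j ≡ true → Inevitable G b i j)
    × ((i : Fin p) (j : Fin q) → InComp G b d (inj₁ i) → InComp G b c (inj₂ j) →
         E i j ≡ true → Forbidden G b i j)
mainTheorem15 G b c hc d ¬hd = inevitable , forbidden
  where
  open BipGraph G
  M-maxm = proj₂ (hooked-maximum G b hc)
  open AlternatingPaths G b M-maxm

  inevitable : ∀ i j → InComp G b c (inj₁ i) → InComp G b d (inj₂ j) → E i j ≡ true → Inevitable G b i j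
  inevitable i j c~i d~j Eij = (_ , M-maxm , contains M-maxm) , λ _ → contains
    where
    contains : ∀ {N} → IsMaximum G b N → N i j ≡ true
    contains N-maxm = assuming-decidable Reachable (decidable-stable (_ Bool.≟ true)) λ X? →
      maximum-contains X? N-maxm (hooked-reachable X? hc c~i) (unhooked-unreachable ¬hd d~j) Eij

  forbidden : ∀ i j → InComp G b d (inj₁ i) → InComp G b c (inj₂ j) → E i j ≡ true → Forbidden G b i j
  forbidden i j d~i c~j Eij = Eij , assuming-decidable Reachable negated-stable λ X? (N , N-maxm , Nij) →
    contradiction (trans (sym Nij) (maximum-avoids X? N-maxm (unhooked-unreachable ¬hd d~i) (hooked-reachable X? hc c~j)))
                  λ ()
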